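{- Let $(G,X,H)$ be obtained from two disjoint degree-feasible configurations $(G^1,X^1,H^1)$ and $(G^2,X^2,H^2)$ by merging $v^1\in V(G^1)$ and $v^2\in V(G^2)$ to a new vertex $v^*$. Then $(G,X,H)$ is a degree-feasible configuration, and the following are equivalent: (a) both $(G^1,X^1,H^1)$ and $(G^2,X^2,H^2)$ are minimal uncolorable; (b) $(G,X,H)$ is minimal uncolorable.
   Context: Hypergraph $G=(V,E,i)$: finite vertex and edge sets, $i:E\to2^V$ with $|i(e)|\ge2$, parallel edges allowed; $d_G(v)$ is the number of edges containing $v$; $G[Y]$ is the induced subhypergraph on $Y$; $Y$ is independent if $G[Y]$ has no edges; $G$ connected means any two vertices are joined by a hyperpath. A cover of $G$ is a pair $(X,H)$: $X$ assigns pairwise disjoint sets $X_v$ to $v\in V(G)$; $H$ is a hypergraph with $V(H)=\bigcup_vX_v$, each $X_v$ independent in $H$, and for each $e\in E(G)$ a possibly empty matching $M_e$ in $H[\bigcup_{v\in i_G(e)}X_v]$ whose edges meet each $X_v$, $v\in i_G(e)$, in exactly one vertex, with $E(H)=\bigcup_eM_e$. A feasible configuration is $(G,X,H)$ with $G$ connected and $(X,H)$ a cover of $G$; degree-feasible if $|X_v|\ge d_G(v)$ for all $v$; colorable if there is an independent set $T$ of $H$ with $|T\cap X_v|=1$ for all $v$, uncolorable otherwise; minimal uncolorable if uncolorable but $(G,X,H-e)$ is colorable for every $e\in E(H)$. Two feasible configurations are disjoint if $V(G^1)\cap V(G^2)=\emptyset$ and $V(H^1)\cap V(H^2)=\emptyset$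 (edge sets also disjoint). Merging $v^1,v^2$ to $v^*$: $G$ has vertex set $(V(G^1)\cup V(G^2)\setminus\{v^1,v^2\})\cup\{v^*\}$, edge set $E(G^1)\cup E(G^2)$, with each edge's vertex set as before except that $v^j$ is replaced by $v^*$; $H=H^1\cup H^2$; $X_{v^*}=X^1_{v^1}\cup X^2_{v^2}$ and $X_v=X^j_v$ for $v\in V(G^j)\setminus\{v^j\}$. -}

module Defs where

open import Data.Bool using (Bool; true; false; T)
open import Data.Nat using (ℕ)
open import Data.Fin using (Fin)
open import Data.Product using (Σ; ∃; ∃-syntax; _×_; _,_)
open import Data.Sum using (_⊎_; inj₁; inj₂)
open import Data.Empty using (⊥)
open import Relation.Nullary using (¬_)
open import Relation.Binary.PropositionalEquality using (_≡_; _≢_)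
open import Relation.Binary.Construct.Closure.ReflexiveTransitive using (Star)
open import Function.Bundles using (_↔_; _↣_; _⇔_)

IsFinite : Set → Set
IsFinite A = Σ ℕ λ n → A ↔ Fin n

ExactlyOne : {A : Set} → (A → Set) → Set
ExactlyOne {A} P = Σ A λ x → P x × (∀ y → P y → y ≡ x)

-- Hypergraphs G = (V, E, i).  The incidence map i : E → 2^V is given
-- as its characteristic function: v ∈ i(e)  iff  T (inc e v).

record Hypergraph : Set₁ where
  field
    V   : Set
    E   : Set
    inc : E → V → Bool

open Hypergraph public

_∈ᵢ_ : {G : Hypergraph} → V G → E G → Set
_∈ᵢ_ {G} v e = T (inc G e v)

IsHypergraph : Hypergraph → Set
IsHypergraph G =
  IsFinite (V G) × IsFinite (E G) ×
  (∀ (e : E G) → ∃[ u ] ∃[ w ] (u ≢ w × _∈ᵢ_ {G} u e × _∈ᵢ_ {G} w e))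

Adjacent : (G : Hypergraph) → V G → V G → Set
Adjacent G u w = ∃[ e ] (_∈ᵢ_ {G} u e × _∈ᵢ_ {G} w e)

Connected : Hypergraph → Set
Connected G = ∀ (u w : V G) → Star (Adjacent G) u w

Independent : (G : Hypergraph) → (V G → Bool) → Set
Independent G Y = ¬ (∃[ f ] (∀ x → _∈ᵢ_ {G} x f → T (Y x)))

deleteEdge : (H : Hypergraph) → E H → Hypergraph
deleteEdge H f = record
  { V   = V H
  ; E   = Σ (E H) (λ f' → f' ≢ f)
  ; inc = λ { (f' , _) x → inc H f' x } }

-- Configurations (G, X, H).  X assigns to each vertex v of G the set
-- X_v ⊆ V(H), given by its characteristic function X v.

record Config : Set₁ where
  field
    G : Hypergraph
    H : Hypergraph
    X : V G → V H → Bool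

open Config public

IsCover : (G H : Hypergraph) → (V G → V H → Bool) → Set
IsCover G H X =
  (∀ u w → u ≢ w → ∀ x → T (X u x) → T (X w x) → ⊥) ×
  (∀ x → ∃[ v ] T (X v x)) ×
  (∀ v → Independent H (X v)) ×
  -- matchings M_e (characteristic function M e of a set of edges of H)
  (Σ (E G → E H → Bool) λ M →
     (∀ e f → T (M e f) → ∀ x → _∈ᵢ_ {H} x f →
        ∃[ v ] (_∈ᵢ_ {G} v e × T (X v x))) ×
     (∀ e f f' → T (M e f) → T (M e f') → f ≢ f' →
        ∀ x → _∈ᵢ_ {H} x f → _∈ᵢ_ {H} x f' → ⊥) ×
     (∀ e f → T (M e f) → ∀ v → _∈ᵢ_ {G} v e →
        ExactlyOne (λ x → _∈ᵢ_ {H} x f × T (X v x))) ×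
     (∀ f → ∃[ e ] T (M e f)))

Feasible : Config → Set
Feasible C =
  IsHypergraph (G C) × IsHypergraph (H C) ×
  Connected (G C) × IsCover (G C) (H C) (X C)

-- |X_v| ≥ d_G(v) for all v, where a ≤ between cardinalities of finite
-- sets means an injection:  {e ∈ E(G) | v ∈ i(e)} ↣ X_v
DegreeFeasible : Config → Set
DegreeFeasible C =
  Feasible C ×
  (∀ (v : V (G C)) →
     Σ (E (G C)) (λ e → _∈ᵢ_ {G C} v e) ↣ Σ (V (H C)) (λ x → T (X C v x)))

Colorable' : (G H : Hypergraph) → (V G → V H → Bool) → Set
Colorable' G H X =
  Σ (V H → Bool) λ T' →
    Independent H T' × (∀ v → ExactlyOne (λ x → T (T' x) × T (X v x)))

Colorable : Config → Set
Colorable C = Colorable' (G C) (H C) (X C)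

MinimalUncolorable : Config → Set
MinimalUncolorable C =
  ¬ Colorable C ×
  (∀ (f : E (H C)) → Colorable' (G C) (deleteEdge (H C) f) (X C))

-- Merging.  Disjointness of the two configurations is realised by
-- taking disjoint unions (tagged copies) of all vertex and edge sets.

module _ (C₁ C₂ : Config) (v₁ : V (G C₁)) (v₂ : V (G C₂)) where

  -- (V(G¹) ∖ {v¹}) ∪ (V(G²) ∖ {v²}) ∪ {v*}
  -- (the side conditions are irrelevant, so equality is the expected one)
  data MergedV : Set where
    star  : MergedV
    left  : (v : V (G C₁)) → .(v ≢ v₁) → MergedV
    right : (w : V (G C₂)) → .(w ≢ v₂) → MergedV

  mergedIncG : E (G C₁) ⊎ E (G C₂) → MergedV → Bool
  mergedIncG (inj₁ e) star        = inc (G C₁) e v₁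
  mergedIncG (inj₁ e) (left v _)  = inc (G C₁) e v
  mergedIncG (inj₁ e) (right _ _) = false
  mergedIncG (inj₂ e) star        = inc (G C₂) e v₂
  mergedIncG (inj₂ e) (left _ _)  = false
  mergedIncG (inj₂ e) (right w _) = inc (G C₂) e w

  mergedG : Hypergraph
  mergedG = record
    { V = MergedV ; E = E (G C₁) ⊎ E (G C₂) ; inc = mergedIncG }

  unionIncH : E (H C₁) ⊎ E (H C₂) → V (H C₁) ⊎ V (H C₂) → Bool
  unionIncH (inj₁ f) (inj₁ x) = inc (H C₁) f x
  unionIncH (inj₁ f) (inj₂ _) = false
  unionIncH (inj₂ f) (inj₁ _) = false
  unionIncH (inj₂ f) (inj₂ y) = inc (H C₂) f y

  unionH : Hypergraph
  unionH = record
    { V = V (H C₁) ⊎ V (H C₂) ; E = E (H C₁) ⊎ E (H C₂) ; inc = unionIncH }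

  mergedX : MergedV → V (H C₁) ⊎ V (H C₂) → Bool
  mergedX star        (inj₁ x) = X C₁ v₁ x
  mergedX star        (inj₂ y) = X C₂ v₂ y
  mergedX (left v _)  (inj₁ x) = X C₁ v x
  mergedX (left v _)  (inj₂ _) = false
  mergedX (right _ _) (inj₁ _) = false
  mergedX (right w _) (inj₂ y) = X C₂ w y

  merge : Config
  merge = record { G = mergedG ; H = unionH ; X = mergedX }

module Submission where

-- 1. Degree-feasibility transfers along the embeddings ι₁, ι₂ of G¹, G² into
--    G (finiteness, connectivity via v*, cover axioms), and
--    d(v*) = d(v¹) + d(v²) ≤ |X¹_{v¹}| + |X²_{v²}| = |X_{v*}|.
-- 2. Key lemma: a degree-feasible configuration can be coloured on G - v,
--    leaving X_v unused.  Colour greedily by decreasing distance to v; a step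
--    colouring u never fails while u has an uncoloured neighbour, since the
--    x ∈ X_u that are blocked inject into the other edges at u, and
--    |X_u| ≥ d(u) (a pigeonhole argument).
-- 3. A colouring of the merge chooses its vertex of X_{v*} on one side and so
--    restricts to a colouring of that side; conversely a colouring of one side
--    glued to a v-avoiding colouring of the other side (from 2) colours the
--    merge.  Applied to H and to every H - f this gives (a) ⇔ (b).

open import Defs
open import Data.Bool using (Bool; true; false; T)
open import Data.Bool.Properties using (T-irrelevant)
open import Data.Empty using (⊥; ⊥-elim; ⊥-elim-irr)
open import Data.Fin as Fin using (Fin)
import Data.Fin.Properties as FinP
import Data.Irrelevant as Irrelevant
open import Data.List using (List; []; _∷_; tabulate)
open import Data.List.Membership.Propositional using (_∈_)
open import Data.List.Membership.Propositional.Properties using (∈-tabulate⁺)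
open import Data.List.Relation.Unary.Any using (here; there)
open import Data.Nat using (ℕ; zero; suc; _+_; _≤_; _≤′_; ≤′-refl; ≤′-step; _⊔_)
import Data.Nat.Properties as ℕP
open import Data.Product using (Σ; ∃; ∃-syntax; _×_; _,_; proj₁; proj₂)
open import Data.Refinement using (Refinement; _,_; value-injective)
open import Data.Sum using (_⊎_; inj₁; inj₂; [_,_])
open import Data.Sum.Function.Propositional using (_⊎-↔_)
open import Data.Sum.Properties using (inj₁-injective; inj₂-injective)
open import Data.Unit using (⊤; tt)
open import Function using (_∘_)
open import Function.Bundles using (Inverse; Injection; Equivalence; _↣_; _⇔_; mk↣; mk↔ₛ′; mk⇔)
open import Function.Construct.Composition using (_↔-∘_; _↣-∘_)
open import Function.Construct.Symmetry using (↔-sym)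
open import Function.Properties.Inverse using (↔⇒↣)
open import Relation.Binary.Construct.Closure.ReflexiveTransitive using (Star; ε; _◅_; _◅◅_; gmap)
open import Relation.Binary.Definitions using (DecidableEquality)
open import Relation.Binary.PropositionalEquality using (_≡_; _≢_; refl; sym; trans; cong; subst)
open import Relation.Nullary using (¬_; Dec; yes; no; ¬?)
open import Relation.Nullary.Decidable using (map′; _×-dec_; _⊎-dec_; _→-dec_; T?; decidable-stable)
open import Relation.Unary using (Decidable)

Σ-T-≡ : {A : Set} {P : A → Bool} {a a' : A} {p : T (P a)} {p' : T (P a')} →
        a ≡ a' → _≡_ {A = Σ A (T ∘ P)} (a , p) (a' , p')
Σ-T-≡ {p = p} {p'} refl = cong (_ ,_) (T-irrelevant p p')

-- The uniform-bound principle over Fin n: take the maximum of the bounds.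
uniformBound-Fin : ∀ n (Q : ℕ → Fin n → Set) → (∀ {j k i} → j ≤ k → Q j i → Q k i) →
                   (∀ i → ∃ λ k → Q k i) → ∃ λ K → ∀ i → Q K i
uniformBound-Fin zero Q mono eventually = 0 , λ ()
uniformBound-Fin (suc n) Q mono eventually
  with k₀ , q₀ ← eventually Fin.zero
     | K , qs ← uniformBound-Fin n (λ k i → Q k (Fin.suc i)) mono (eventually ∘ Fin.suc)
  = k₀ ⊔ K , λ { Fin.zero → mono (ℕP.m≤m⊔n k₀ K) q₀ ; (Fin.suc i) → mono (ℕP.m≤n⊔m k₀ K) (qs i) }

module Finite {A : Set} (fin : IsFinite A) where
  open Inverse (proj₂ fin) using (to; from; strictlyInverseʳ)

  _≟_ : DecidableEquality A
  _≟_ = FinP.inj⇒≟ (↔⇒↣ (proj₂ fin))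

  ∃? : {P : A → Set} → Decidable P → Dec (∃ P)
  ∃? {P} P? = map′ (λ (i , p) → from i , p)
    (λ (a , p) → to a , subst P (sym (strictlyInverseʳ a)) p) (FinP.any? (P? ∘ from))

  ∀? : {P : A → Set} → Decidable P → Dec (∀ a → P a)
  ∀? {P} P? = map′ (λ p a → subst P (strictlyInverseʳ a) (p (to a)))
    (λ p i → p (from i)) (FinP.all? (P? ∘ from))

  elements : List A
  elements = tabulate from

  ∈-elements : ∀ a → a ∈ elements
  ∈-elements a = subst (_∈ elements) (strictlyInverseʳ a) (∈-tabulate⁺ (to a))

  uniformBound : (Q : ℕ → A → Set) → (∀ {j k a} → j ≤ k → Q j a → Q k a) →
                 (∀ a → ∃ λ k → Q k a) → ∃ λ K → ∀ a → Q K a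
  uniformBound Q mono eventually
    with K , always ← uniformBound-Fin (proj₁ fin) (λ k i → Q k (from i)) mono (eventually ∘ from)
    = K , λ a → subst (Q K) (strictlyInverseʳ a) (always (to a))

noInjection-⊤⊎ : {A : Set} → IsFinite A → ¬ ((⊤ ⊎ A) ↣ A)
noInjection-⊤⊎ (n , A↔Fin) f = ℕP.1+n≰n (FinP.injective⇒≤ (Injection.injective shrink))
  where
  shrink : Fin (suc n) ↣ Fin n
  shrink = ↔⇒↣ A↔Fin ↣-∘ (f ↣-∘ ↔⇒↣ ((FinP.1↔⊤ ⊎-↔ ↔-sym A↔Fin) ↔-∘ FinP.+↔⊎ {1} {n}))

-- The pigeonhole principle for a decidable subset B of a finite type A,
-- obtained by extending an injection ⊤ ⊎ B ↣ B by the identity outside B.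
noInjection-subset : {A : Set} → IsFinite A → (P : A → Bool) →
                     ¬ ((⊤ ⊎ Σ A (T ∘ P)) ↣ Σ A (T ∘ P))
noInjection-subset {A} fin P f = noInjection-⊤⊎ fin (mk↣ {to = extended} extended-injective)
  where
  open Injection f using () renaming (to to f-to; injective to f-injective)

  onElement : (a : A) → Dec (T (P a)) → A
  onElement a (yes p) = proj₁ (f-to (inj₂ (a , p)))
  onElement a (no _)  = a

  extended : ⊤ ⊎ A → A
  extended (inj₁ tt) = proj₁ (f-to (inj₁ tt))
  extended (inj₂ a)  = onElement a (T? (P a))

  forget : ⊤ ⊎ Σ A (T ∘ P) → ⊤ ⊎ A
  forget (inj₁ tt)      = inj₁ tt
  forget (inj₂ (a , _)) = inj₂ a

  classify : ∀ z → (∃ λ z' → forget z' ≡ z × extended z ≡ proj₁ (f-to z')) ⊎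
                   (∃ λ a → z ≡ inj₂ a × ¬ T (P a) × extended z ≡ a)
  classify (inj₁ tt) = inj₁ (inj₁ tt , refl , refl)
  classify (inj₂ a) with T? (P a)
  ... | yes p = inj₁ (inj₂ (a , p) , refl , refl)
  ... | no ¬p = inj₂ (a , refl , ¬p , refl)

  extended-injective : ∀ {z₁ z₂} → extended z₁ ≡ extended z₂ → z₁ ≡ z₂
  extended-injective {z₁} {z₂} eq with classify z₁ | classify z₂
  ... | inj₁ (z₁' , refl , e₁) | inj₁ (z₂' , refl , e₂) =
    cong forget (f-injective (Σ-T-≡ (trans (sym e₁) (trans eq e₂))))
  ... | inj₁ (z' , _ , e₁) | inj₂ (a , _ , ¬p , e₂) =
    ⊥-elim (¬p (subst (T ∘ P) (trans (sym e₁) (trans eq e₂)) (proj₂ (f-to z'))))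
  ... | inj₂ (a , _ , ¬p , e₁) | inj₁ (z' , _ , e₂) =
    ⊥-elim (¬p (subst (T ∘ P) (trans (sym e₂) (trans (sym eq) e₁)) (proj₂ (f-to z'))))
  ... | inj₂ (a , refl , _ , e₁) | inj₂ (b , refl , _ , e₂) =
    cong inj₂ (trans (sym e₁) (trans eq e₂))

finite-⊤ : IsFinite ⊤
finite-⊤ = 1 , ↔-sym FinP.1↔⊤

finite-⊎ : {A B : Set} → IsFinite A → IsFinite B → IsFinite (A ⊎ B)
finite-⊎ (m , A↔m) (n , B↔n) = m + n , ↔-sym FinP.+↔⊎ ↔-∘ (A↔m ⊎-↔ B↔n)

finite-without : {A : Set} → IsFinite A → (a₀ : A) → IsFinite (Refinement A (_≢ a₀))
finite-without (zero , A↔0) a₀ = ⊥-elim (FinP.¬Fin0 (Inverse.to A↔0 a₀))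
finite-without {A} (suc n , A↔n) a₀ = n , mk↔ₛ′ to from to-from from-to
  where
  open Inverse A↔n using () renaming (to to index; from to element; strictlyInverseˡ to index-element;
                                      strictlyInverseʳ to element-index)
  index-injective : ∀ {a b} → index a ≡ index b → a ≡ b
  index-injective {a} {b} eq = trans (sym (element-index a)) (trans (cong element eq) (element-index b))
  to : Refinement A (_≢ a₀) → Fin n
  to (a , Irrelevant.[ a≢a₀ ]) = Fin.punchOut {i = index a₀} {j = index a} (λ eq → ⊥-elim-irr (a≢a₀ (index-injective (sym eq))))
  from : Fin n → Refinement A (_≢ a₀)
  from k = element (Fin.punchIn (index a₀) k) ,
           Irrelevant.[ (λ eq → FinP.punchInᵢ≢i (index a₀) k (trans (sym (index-element _)) (cong index eq))) ]
  to-from : ∀ k → to (from k) ≡ k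
  to-from k = trans (FinP.punchOut-cong (index a₀) (index-element _)) (FinP.punchOut-punchIn (index a₀))
  from-to : ∀ r → from (to r) ≡ r
  from-to (a , _) = value-injective (trans (cong element (FinP.punchIn-punchOut _)) (element-index a))

ExactlyOne-inj₁ : {A B : Set} {P : A ⊎ B → Set} {a : A} →
                  P (inj₁ a) → (∀ z → P z → z ≡ inj₁ a) → ExactlyOne (P ∘ inj₁)
ExactlyOne-inj₁ p unique = _ , p , λ a' p' → inj₁-injective (unique (inj₁ a') p')

ExactlyOne-inj₂ : {A B : Set} {P : A ⊎ B → Set} {b : B} →
                  P (inj₂ b) → (∀ z → P z → z ≡ inj₂ b) → ExactlyOne (P ∘ inj₂)
ExactlyOne-inj₂ p unique = _ , p , λ b' p' → inj₂-injective (unique (inj₂ b') p')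

ExactlyOne-inj₁⁻ : {A B : Set} {P : A ⊎ B → Set} → (∀ b → ¬ P (inj₂ b)) →
                   ExactlyOne P → ExactlyOne (P ∘ inj₁)
ExactlyOne-inj₁⁻ _  (inj₁ a , p , unique) = ExactlyOne-inj₁ p unique
ExactlyOne-inj₁⁻ ¬P (inj₂ b , p , _)      = ⊥-elim (¬P b p)

ExactlyOne-inj₂⁻ : {A B : Set} {P : A ⊎ B → Set} → (∀ a → ¬ P (inj₁ a)) →
                   ExactlyOne P → ExactlyOne (P ∘ inj₂)
ExactlyOne-inj₂⁻ ¬P (inj₁ a , p , _)      = ⊥-elim (¬P a p)
ExactlyOne-inj₂⁻ _  (inj₂ b , p , unique) = ExactlyOne-inj₂ p unique

ExactlyOne-inj₁⁺ : {A B : Set} {P : A ⊎ B → Set} → (∀ b → ¬ P (inj₂ b)) →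
                   ExactlyOne (P ∘ inj₁) → ExactlyOne P
ExactlyOne-inj₁⁺ {P = P} ¬P (a , p , unique) = inj₁ a , p , only
  where
  only : ∀ z → P z → z ≡ inj₁ a
  only (inj₁ a') p' = cong inj₁ (unique a' p')
  only (inj₂ b)  p' = ⊥-elim (¬P b p')

ExactlyOne-inj₂⁺ : {A B : Set} {P : A ⊎ B → Set} → (∀ a → ¬ P (inj₁ a)) →
                   ExactlyOne (P ∘ inj₂) → ExactlyOne P
ExactlyOne-inj₂⁺ {P = P} ¬P (b , p , unique) = inj₂ b , p , only
  where
  only : ∀ z → P z → z ≡ inj₂ b
  only (inj₁ a)  p' = ⊥-elim (¬P a p')
  only (inj₂ b') p' = cong inj₂ (unique b' p')

ExactlyOne-resp : {A : Set} {P Q : A → Set} → (∀ a → P a → Q a) → (∀ a → Q a → P a) →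
                  ExactlyOne P → ExactlyOne Q
ExactlyOne-resp P⇒Q Q⇒P (a , p , unique) = a , P⇒Q a p , λ b → unique b ∘ Q⇒P b

injection-Σ⊎ : {A₁ A₂ B₁ B₂ : Set} (P : A₁ ⊎ A₂ → Bool) (Q : B₁ ⊎ B₂ → Bool) →
               Σ A₁ (T ∘ P ∘ inj₁) ↣ Σ B₁ (T ∘ Q ∘ inj₁) →
               Σ A₂ (T ∘ P ∘ inj₂) ↣ Σ B₂ (T ∘ Q ∘ inj₂) →
               Σ (A₁ ⊎ A₂) (T ∘ P) ↣ Σ (B₁ ⊎ B₂) (T ∘ Q)
injection-Σ⊎ P Q f₁ f₂ = mk↣ {to = to} to-injective
  where
  open Injection f₁ using () renaming (to to to₁; injective to injective₁)
  open Injection f₂ using () renaming (to to to₂; injective to injective₂)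
  to : Σ _ (T ∘ P) → Σ _ (T ∘ Q)
  to (inj₁ a , p) = inj₁ (proj₁ (to₁ (a , p))) , proj₂ (to₁ (a , p))
  to (inj₂ a , p) = inj₂ (proj₁ (to₂ (a , p))) , proj₂ (to₂ (a , p))
  to-injective : ∀ {x y} → to x ≡ to y → x ≡ y
  to-injective {inj₁ a , _} {inj₁ b , _} eq =
    Σ-T-≡ (cong (inj₁ ∘ proj₁) (injective₁ (Σ-T-≡ (inj₁-injective (cong proj₁ eq)))))
  to-injective {inj₂ a , _} {inj₂ b , _} eq =
    Σ-T-≡ (cong (inj₂ ∘ proj₁) (injective₂ (Σ-T-≡ (inj₂-injective (cong proj₁ eq)))))
  to-injective {inj₁ _ , _} {inj₂ _ , _} eq with () ← cong proj₁ eq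
  to-injective {inj₂ _ , _} {inj₁ _ , _} eq with () ← cong proj₁ eq

injection-∅ : {A B : Set} → Σ A (λ _ → T false) ↣ B
injection-∅ = mk↣ {to = λ ()} (λ { {()} })

module DegreeFeasibleParts {C : Config} (df : DegreeFeasible C) where

  _∈ᴳ_ : V (G C) → E (G C) → Set
  u ∈ᴳ e = T (inc (G C) e u)

  _∈ᴴ_ : V (H C) → E (H C) → Set
  x ∈ᴴ f = T (inc (H C) f x)

  finiteVᴳ : IsFinite (V (G C))
  finiteVᴳ = proj₁ (proj₁ (proj₁ df))

  finiteEᴳ : IsFinite (E (G C))
  finiteEᴳ = proj₁ (proj₂ (proj₁ (proj₁ df)))

  twoEndsᴳ : ∀ e → ∃[ u ] ∃[ w ] (u ≢ w × u ∈ᴳ e × w ∈ᴳ e)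
  twoEndsᴳ = proj₂ (proj₂ (proj₁ (proj₁ df)))

  finiteVᴴ : IsFinite (V (H C))
  finiteVᴴ = proj₁ (proj₁ (proj₂ (proj₁ df)))

  finiteEᴴ : IsFinite (E (H C))
  finiteEᴴ = proj₁ (proj₂ (proj₁ (proj₂ (proj₁ df))))

  twoEndsᴴ : ∀ f → ∃[ x ] ∃[ y ] (x ≢ y × x ∈ᴴ f × y ∈ᴴ f)
  twoEndsᴴ = proj₂ (proj₂ (proj₁ (proj₂ (proj₁ df))))

  connected : Connected (G C)
  connected = proj₁ (proj₂ (proj₂ (proj₁ df)))

  cover : IsCover (G C) (H C) (X C)
  cover = proj₂ (proj₂ (proj₂ (proj₁ df)))

  disjoint : ∀ u w → u ≢ w → ∀ x → T (X C u x) → T (X C w x) → ⊥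
  disjoint = proj₁ cover

  covered : ∀ x → ∃[ v ] T (X C v x)
  covered = proj₁ (proj₂ cover)

  classIndependent : ∀ v → Independent (H C) (X C v)
  classIndependent = proj₁ (proj₂ (proj₂ cover))

  M : E (G C) → E (H C) → Bool
  M = proj₁ (proj₂ (proj₂ (proj₂ cover)))

  M-inside : ∀ e f → T (M e f) → ∀ x → x ∈ᴴ f → ∃[ v ] (v ∈ᴳ e × T (X C v x))
  M-inside = proj₁ (proj₂ (proj₂ (proj₂ (proj₂ cover))))

  M-matching : ∀ e f f' → T (M e f) → T (M e f') → f ≢ f' → ∀ x → x ∈ᴴ f → x ∈ᴴ f' → ⊥
  M-matching = proj₁ (proj₂ (proj₂ (proj₂ (proj₂ (proj₂ cover)))))

  M-meets : ∀ e f → T (M e f) → ∀ v → v ∈ᴳ e → ExactlyOne (λ x → x ∈ᴴ f × T (X C v x))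
  M-meets = proj₁ (proj₂ (proj₂ (proj₂ (proj₂ (proj₂ (proj₂ cover))))))

  M-covers : ∀ f → ∃[ e ] T (M e f)
  M-covers = proj₂ (proj₂ (proj₂ (proj₂ (proj₂ (proj₂ (proj₂ cover))))))

  M-meetsOnce : ∀ e f → T (M e f) → ∀ v → v ∈ᴳ e → ∀ {z z'} →
                z ∈ᴴ f → T (X C v z) → z' ∈ᴴ f → T (X C v z') → z ≡ z'
  M-meetsOnce e f m v v∈e {z} {z'} z∈ zv z'∈ z'v =
    trans (unique z (z∈ , zv)) (sym (unique z' (z'∈ , z'v)))
    where unique = proj₂ (proj₂ (M-meets e f m v v∈e))

  degree : ∀ v → Σ (E (G C)) (v ∈ᴳ_) ↣ Σ (V (H C)) (T ∘ X C v)
  degree = proj₂ df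

  _≟ᴳ_ : DecidableEquality (V (G C))
  _≟ᴳ_ = Finite._≟_ finiteVᴳ

  _≟ᴴ_ : DecidableEquality (V (H C))
  _≟ᴴ_ = Finite._≟_ finiteVᴴ

  sameClass : ∀ {u w x} → T (X C u x) → T (X C w x) → u ≡ w
  sameClass {u} {w} {x} xu xw with u ≟ᴳ w
  ... | yes u≡w = u≡w
  ... | no u≢w  = ⊥-elim (disjoint u w u≢w x xu xw)

  otherEnd : ∀ e u → ∃[ w ] (w ∈ᴳ e × w ≢ u)
  otherEnd e u with twoEndsᴳ e
  ... | a , b , a≢b , a∈e , b∈e with a ≟ᴳ u
  ... | yes refl = b , b∈e , λ b≡a → a≢b (sym b≡a)
  ... | no a≢u   = a , a∈e , a≢u

Everywhere : {A : Set} → A → Set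
Everywhere _ = ⊤

record Transversal {A B : Set} (X : A → B → Bool) (S : A → Set) (T' : B → Bool) : Set where
  constructor transversal
  field
    exactlyOne : ∀ w → S w → ExactlyOne (λ x → T (T' x) × T (X w x))
    avoids     : ∀ w → ¬ S w → ∀ x → T (T' x) → T (X w x) → ⊥

fullTransversal : ∀ {A B} {X : A → B → Bool} {T' : B → Bool} →
                  (∀ w → ExactlyOne (λ x → T (T' x) × T (X w x))) → Transversal X Everywhere T'
fullTransversal one = transversal (λ w _ → one w) (λ _ nowhere → ⊥-elim (nowhere tt))

Transversal-resp : ∀ {A B X S S'} {T' : B → Bool} → (∀ (w : A) → S w → S' w) → (∀ w → S' w → S w) →
                   Transversal X S T' → Transversal X S' T'
Transversal-resp S⊆S' S'⊆S (transversal one avoids) =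
  transversal (λ w → one w ∘ S'⊆S w) (λ w ¬S'w → avoids w (¬S'w ∘ S⊆S' w))

record PartialColoring (C : Config) (S : V (G C) → Set) (T' : V (H C) → Bool) : Set where
  constructor partialColoring
  field
    independent : Independent (H C) T'
    isTransversal : Transversal (X C) S T'
  open Transversal isTransversal public

PartialColoring-resp : ∀ {C S S' T'} → (∀ w → S w → S' w) → (∀ w → S' w → S w) →
                       PartialColoring C S T' → PartialColoring C S' T'
PartialColoring-resp S⊆S' S'⊆S (partialColoring independent tr) =
  partialColoring independent (Transversal-resp S⊆S' S'⊆S tr)

atMostOnce : ∀ {C S T'} → Decidable S → PartialColoring C S T' →
             ∀ {w y y'} → T (T' y) → T (X C w y) → T (T' y') → T (X C w y') → y ≡ y'
atMostOnce S? pc {w} {y} {y'} ty yw ty' y'w with S? w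
... | yes Sw = trans (unique y (ty , yw)) (sym (unique y' (ty' , y'w)))
  where unique = proj₂ (proj₂ (PartialColoring.exactlyOne pc w Sw))
... | no ¬Sw = ⊥-elim (PartialColoring.avoids pc w ¬Sw y ty yw)

module Greedy {C : Config} (df : DegreeFeasible C) where
  open DegreeFeasibleParts df

  EdgeInside : (V (H C) → Bool) → Set
  EdgeInside T' = ∃[ f ] (∀ y → y ∈ᴴ f → T (T' y))

  edgeInside? : ∀ T' → Dec (EdgeInside T')
  edgeInside? T' = Finite.∃? finiteEᴴ λ f →
    Finite.∀? finiteVᴴ λ y → T? (inc (H C) f y) →-dec T? (T' y)

  _+ᵀ_ : (V (H C) → Bool) → V (H C) → V (H C) → Bool
  (T' +ᵀ x) y with y ≟ᴴ x
  ... | yes _ = true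
  ... | no _  = T' y

  +ᵀ-cases : ∀ {T' x y} → T ((T' +ᵀ x) y) → y ≡ x ⊎ T (T' y)
  +ᵀ-cases {T'} {x} {y} t with y ≟ᴴ x
  ... | yes y≡x = inj₁ y≡x
  ... | no _    = inj₂ t

  +ᵀ-old : ∀ {T' x y} → T (T' y) → T ((T' +ᵀ x) y)
  +ᵀ-old {T'} {x} {y} t with y ≟ᴴ x
  ... | yes _ = tt
  ... | no _  = t

  +ᵀ-new : ∀ {T' x} → T ((T' +ᵀ x) x)
  +ᵀ-new {T'} {x} with x ≟ᴴ x
  ... | yes _   = tt
  ... | no x≢x  = ⊥-elim (x≢x refl)

  -- Each x ∈ X_u
  -- whose addition creates an edge of H is charged to an edge of G at u
  -- other than e₀; this charging is injective, so |X_u| ≥ d(u) rules out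
  -- that every x ∈ X_u is blocked.
  module Extension {S : V (G C) → Set} (S? : Decidable S) {T' : V (H C) → Bool}
                   (pc : PartialColoring C S T') {u : V (G C)} (¬Su : ¬ S u)
                   {e₀ : E (G C)} {w₀ : V (G C)} (u∈e₀ : u ∈ᴳ e₀) (w₀∈e₀ : w₀ ∈ᴳ e₀)
                   (w₀≢u : w₀ ≢ u) (¬Sw₀ : ¬ S w₀) where
    open PartialColoring pc

    Xᵤ : Set
    Xᵤ = Σ (V (H C)) (T ∘ X C u)

    module AllBlocked (blocked : ((x , _) : Xᵤ) → EdgeInside (T' +ᵀ x)) where

      block : Xᵤ → E (H C)
      block x = proj₁ (blocked x)

      -- the blocking edge contains x, since T' itself is independent
      x∈block : ((x , xu) : Xᵤ) → x ∈ᴴ block (x , xu)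
      x∈block x̂@(x , _) with T? (inc (H C) (block x̂) x)
      ... | yes x∈ = x∈
      ... | no x∉  = ⊥-elim (independent (block x̂ , inT'))
        where
        inT' : ∀ y → y ∈ᴴ block x̂ → T (T' y)
        inT' y y∈ with +ᵀ-cases (proj₂ (blocked x̂) y y∈)
        ... | inj₁ refl = ⊥-elim (x∉ y∈)
        ... | inj₂ t    = t

      outsideInT' : ∀ x̂ {w y} → w ≢ u → T (X C w y) → y ∈ᴴ block x̂ → T (T' y)
      outsideInT' x̂@(x , xu) w≢u yw y∈ with +ᵀ-cases (proj₂ (blocked x̂) _ y∈)
      ... | inj₁ refl = ⊥-elim (w≢u (sameClass yw xu))
      ... | inj₂ t    = t

      -- the owner of a blocking edge: the edge e of G with block x ∈ M_e;
      -- it contains u, but not e₀ whose other end w₀ is uncoloured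
      owner : Xᵤ → E (G C)
      owner x̂ = proj₁ (M-covers (block x̂))

      inM : ∀ x̂ → T (M (owner x̂) (block x̂))
      inM x̂ = proj₂ (M-covers (block x̂))

      u∈owner : ∀ x̂ → u ∈ᴳ owner x̂
      u∈owner x̂@(x , xu) with M-inside _ _ (inM x̂) x (x∈block x̂)
      ... | w , w∈ , xw = subst (_∈ᴳ owner x̂) (sameClass xw xu) w∈

      owner≢e₀ : ∀ x̂ → owner x̂ ≢ e₀
      owner≢e₀ x̂ refl with M-meets _ _ (inM x̂) w₀ w₀∈e₀
      ... | y , (y∈ , yw₀) , _ = avoids w₀ ¬Sw₀ y (outsideInT' x̂ w₀≢u yw₀ y∈) yw₀

      inM-same : ∀ x̂ x̂' → owner x̂ ≡ owner x̂' → T (M (owner x̂) (block x̂'))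
      inM-same x̂ x̂' same = subst (λ e → T (M e (block x̂'))) (sym same) (inM x̂')

      -- blocking edges in one matching M_e meet X_w (w ∈ e, w ≠ u) in the same
      -- vertex, the one coloured in X_w; so they coincide
      sameBlock : ∀ x̂ x̂' → owner x̂ ≡ owner x̂' → block x̂ ≡ block x̂'
      sameBlock x̂ x̂' same with otherEnd (owner x̂) u
      ... | w , w∈ , w≢u
          with M-meets _ _ (inM x̂) w w∈ | M-meets _ _ (inM-same x̂ x̂' same) w w∈
             | Finite._≟_ finiteEᴴ (block x̂) (block x̂')
      ... | _ | _ | yes equal = equal
      ... | y , (y∈ , yw) , _ | y' , (y'∈ , y'w) , _ | no distinct =
        ⊥-elim (M-matching _ _ _ (inM x̂) (inM-same x̂ x̂' same) distinct y y∈
                  (subst (_∈ᴴ block x̂') (sym y≡y') y'∈))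
        where
        y≡y' : y ≡ y'
        y≡y' = atMostOnce S? pc (outsideInT' x̂ w≢u yw y∈) yw (outsideInT' x̂' w≢u y'w y'∈) y'w

      owner-injective : ∀ {x̂ x̂'} → owner x̂ ≡ owner x̂' → x̂ ≡ x̂'
      owner-injective {x̂@(x , xu)} {x̂'@(x' , xu')} same =
        Σ-T-≡ (M-meetsOnce _ _ (inM x̂) u (u∈owner x̂) (x∈block x̂) xu x'∈block xu')
        where
        x'∈block : x' ∈ᴴ block x̂
        x'∈block = subst (x' ∈ᴴ_) (sym (sameBlock x̂ x̂' same)) (x∈block x̂')

      -- charging: e₀ and the owners of all x ∈ X_u are distinct edges at u,
      -- which the degree bound maps injectively back into X_u
      charge : (⊤ ⊎ Xᵤ) ↣ Xᵤ
      charge = mk↣ {to = to} to-injective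
        where
        to : ⊤ ⊎ Xᵤ → Xᵤ
        to (inj₁ tt) = Injection.to (degree u) (e₀ , u∈e₀)
        to (inj₂ x̂)  = Injection.to (degree u) (owner x̂ , u∈owner x̂)
        sameEdge : ∀ {e e' p p'} → Injection.to (degree u) (e , p) ≡ Injection.to (degree u) (e' , p') → e ≡ e'
        sameEdge = cong proj₁ ∘ Injection.injective (degree u)
        to-injective : ∀ {a b} → to a ≡ to b → a ≡ b
        to-injective {inj₁ tt} {inj₁ tt} _  = refl
        to-injective {inj₁ tt} {inj₂ x̂}  eq = ⊥-elim (owner≢e₀ x̂ (sym (sameEdge eq)))
        to-injective {inj₂ x̂}  {inj₁ tt} eq = ⊥-elim (owner≢e₀ x̂ (sameEdge eq))
        to-injective {inj₂ x̂}  {inj₂ x̂'} eq = cong inj₂ (owner-injective (sameEdge eq))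

      impossible : ⊥
      impossible = noInjection-subset finiteVᴴ (X C u) charge

    extend : Σ (V (H C) → Bool) (PartialColoring C (λ w → S w ⊎ w ≡ u))
    extend with Finite.∃? finiteVᴴ (λ x → T? (X C u x) ×-dec ¬? (edgeInside? (T' +ᵀ x)))
    ... | no noChoice = ⊥-elim (AllBlocked.impossible λ (x , xu) →
            decidable-stable (edgeInside? _) (λ free → noChoice (x , xu , free)))
    ... | yes (x , xu , free) = T' +ᵀ x , partialColoring free (transversal one' avoids')
      where
      one' : ∀ w → S w ⊎ w ≡ u → ExactlyOne (λ y → T ((T' +ᵀ x) y) × T (X C w y))
      one' w (inj₁ Sw) with exactlyOne w Sw
      ... | z , (tz , zw) , unique = z , (+ᵀ-old tz , zw) , onlyZ
        where
        onlyZ : ∀ y → T ((T' +ᵀ x) y) × T (X C w y) → y ≡ z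
        onlyZ y (ty , yw) with +ᵀ-cases ty
        ... | inj₁ refl = ⊥-elim (¬Su (subst S (sameClass yw xu) Sw))
        ... | inj₂ t    = unique y (t , yw)
      one' w (inj₂ refl) = x , (+ᵀ-new , xu) , onlyX
        where
        onlyX : ∀ y → T ((T' +ᵀ x) y) × T (X C u y) → y ≡ x
        onlyX y (ty , yu) with +ᵀ-cases ty
        ... | inj₁ y≡x = y≡x
        ... | inj₂ t   = ⊥-elim (avoids u ¬Su y t yu)

      avoids' : ∀ w → ¬ (S w ⊎ w ≡ u) → ∀ y → T ((T' +ᵀ x) y) → T (X C w y) → ⊥
      avoids' w ¬new y ty yw with +ᵀ-cases ty
      ... | inj₁ refl = ¬new (inj₂ (sameClass yw xu))
      ... | inj₂ t    = avoids w (¬new ∘ inj₁) y t yw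

  colourList : {P S : V (G C) → Set} → Decidable P → Decidable S →
               (∀ w → P w → ¬ S w) →
               (∀ u → ¬ P u → ¬ S u → ∃[ e ] ∃[ w ] (u ∈ᴳ e × w ∈ᴳ e × P w)) →
               (us : List (V (G C))) → {T' : V (H C) → Bool} → PartialColoring C S T' →
               Σ (V (H C) → Bool) (PartialColoring C (λ w → S w ⊎ (w ∈ us × ¬ P w)))
  colourList P? S? P⇒¬S meetsP [] pc =
    _ , PartialColoring-resp (λ _ → inj₁) (λ { w (inj₁ Sw) → Sw ; w (inj₂ (() , _)) }) pc
  colourList {P} {S} P? S? P⇒¬S meetsP (u ∷ us) pc with P? u ⊎-dec S? u
  ... | yes skip = _ , PartialColoring-resp forth back (proj₂ (colourList P? S? P⇒¬S meetsP us pc))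
    where
    forth : ∀ w → S w ⊎ (w ∈ us × ¬ P w) → S w ⊎ (w ∈ u ∷ us × ¬ P w)
    forth w (inj₁ Sw)         = inj₁ Sw
    forth w (inj₂ (w∈ , ¬Pw)) = inj₂ (there w∈ , ¬Pw)
    back : ∀ w → S w ⊎ (w ∈ u ∷ us × ¬ P w) → S w ⊎ (w ∈ us × ¬ P w)
    back w (inj₁ Sw)                = inj₁ Sw
    back w (inj₂ (here refl , ¬Pw)) = [ ⊥-elim ∘ ¬Pw , inj₁ ] skip
    back w (inj₂ (there w∈ , ¬Pw))  = inj₂ (w∈ , ¬Pw)
  ... | no ¬skip with meetsP u (¬skip ∘ inj₁) (¬skip ∘ inj₂)
  ... | e , w , u∈e , w∈e , Pw =
    _ , PartialColoring-resp forth back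
          (proj₂ (colourList P? S'? P⇒¬S' (λ u' ¬Pu' ¬S'u' → meetsP u' ¬Pu' (¬S'u' ∘ inj₁)) us
                    (proj₂ (Extension.extend S? pc (¬skip ∘ inj₂) u∈e w∈e w≢u (P⇒¬S w Pw)))))
    where
    S' : V (G C) → Set
    S' w = S w ⊎ w ≡ u
    S'? : Decidable S'
    S'? w = S? w ⊎-dec (w ≟ᴳ u)
    w≢u : w ≢ u
    w≢u refl = ¬skip (inj₁ Pw)
    P⇒¬S' : ∀ w → P w → ¬ S' w
    P⇒¬S' w Pw (inj₁ Sw)  = P⇒¬S w Pw Sw
    P⇒¬S' w Pw (inj₂ refl) = ¬skip (inj₁ Pw)
    forth : ∀ w → S' w ⊎ (w ∈ us × ¬ P w) → S w ⊎ (w ∈ u ∷ us × ¬ P w)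
    forth w (inj₁ (inj₁ Sw))   = inj₁ Sw
    forth w (inj₁ (inj₂ refl)) = inj₂ (here refl , ¬skip ∘ inj₁)
    forth w (inj₂ (w∈ , ¬Pw))  = inj₂ (there w∈ , ¬Pw)
    back : ∀ w → S w ⊎ (w ∈ u ∷ us × ¬ P w) → S' w ⊎ (w ∈ us × ¬ P w)
    back w (inj₁ Sw)                = inj₁ (inj₁ Sw)
    back w (inj₂ (here refl , _))   = inj₁ (inj₂ refl)
    back w (inj₂ (there w∈ , ¬Pw))  = inj₂ (w∈ , ¬Pw)

-- Colour greedily in order of decreasing distance from v:
-- each vertex at distance k+1 has a neighbour at distance k, still uncoloured.
module AvoidVertex {C : Config} (df : DegreeFeasible C) (v : V (G C)) where
  open DegreeFeasibleParts df
  open Greedy df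

  vertices : List (V (G C))
  vertices = Finite.elements finiteVᴳ

  adjacent? : ∀ a b → Dec (Adjacent (G C) a b)
  adjacent? a b = Finite.∃? finiteEᴳ (λ e → T? (inc (G C) e a) ×-dec T? (inc (G C) e b))

  Within : ℕ → V (G C) → Set
  Within zero    w = w ≡ v
  Within (suc k) w = Within k w ⊎ ∃[ w' ] (Adjacent (G C) w w' × Within k w')

  within? : ∀ k → Decidable (Within k)
  within? zero    w = w ≟ᴳ v
  within? (suc k) w = within? k w ⊎-dec Finite.∃? finiteVᴳ (λ w' → adjacent? w w' ×-dec within? k w')

  within-mono : ∀ {j k w} → j ≤ k → Within j w → Within k w
  within-mono j≤k = go (ℕP.≤⇒≤′ j≤k)
    where
    go : ∀ {j k w} → j ≤′ k → Within j w → Within k w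
    go ≤′-refl        r = r
    go (≤′-step j≤′k) r = inj₁ (go j≤′k r)

  pathWithin : ∀ {w} → Star (Adjacent (G C)) w v → ∃ λ k → Within k w
  pathWithin ε              = 0 , refl
  pathWithin (step ◅ path) with pathWithin path
  ... | k , within = suc k , inj₂ (_ , step , within)

  allWithin : ∃ λ K → ∀ w → Within K w
  allWithin = Finite.uniformBound finiteVᴳ Within within-mono (λ w → pathWithin (connected w v))

  Beyond : ℕ → Set
  Beyond k = Σ (V (H C) → Bool) (PartialColoring C (λ w → ¬ Within k w))

  nothingBeyond : ∀ {K} → (∀ w → Within K w) → Beyond K
  nothingBeyond all = (λ _ → false) , partialColoring emptyIndependent
                        (transversal (λ w ¬within → ⊥-elim (¬within (all w))) (λ _ _ _ ()))
    where
    emptyIndependent : Independent (H C) (λ _ → false)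
    emptyIndependent (f , inside) with twoEndsᴴ f
    ... | x , _ , _ , x∈f , _ = inside x x∈f

  -- colour the layer at distance k+1, protecting the vertices within k
  layer : ∀ k → Beyond (suc k) → Beyond k
  layer k (_ , pc) =
    _ , PartialColoring-resp forth back
          (proj₂ (colourList (within? k) (¬? ∘ within? (suc k)) (λ w Wk ¬Wsk → ¬Wsk (inj₁ Wk))
                    meetsLayer vertices pc))
    where
    meetsLayer : ∀ u → ¬ Within k u → ¬ ¬ Within (suc k) u →
                 ∃[ e ] ∃[ w ] (u ∈ᴳ e × w ∈ᴳ e × Within k w)
    meetsLayer u ¬Wk ¬¬Wsk with decidable-stable (within? (suc k) u) ¬¬Wsk
    ... | inj₁ Wk                         = ⊥-elim (¬Wk Wk)
    ... | inj₂ (w , (e , u∈e , w∈e) , Wk) = e , w , u∈e , w∈e , Wk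
    forth : ∀ w → ¬ Within (suc k) w ⊎ (w ∈ vertices × ¬ Within k w) → ¬ Within k w
    forth w (inj₁ ¬Wsk)      = ¬Wsk ∘ inj₁
    forth w (inj₂ (_ , ¬Wk)) = ¬Wk
    back : ∀ w → ¬ Within k w → ¬ Within (suc k) w ⊎ (w ∈ vertices × ¬ Within k w)
    back w ¬Wk = inj₂ (Finite.∈-elements finiteVᴳ w , ¬Wk)

  descend : ∀ j k → Beyond (j + k) → Beyond k
  descend zero    k coloured = coloured
  descend (suc j) k coloured = descend j k (layer (j + k) coloured)

  colouring : Σ (V (H C) → Bool) (PartialColoring C (_≢ v))
  colouring with K , all ← allWithin =
    descend K 0 (subst Beyond (sym (ℕP.+-identityʳ K)) (nothingBeyond all))

IndependentOn : (H : Hypergraph) → (E H → Set) → (V H → Bool) → Set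
IndependentOn H K T' = ∀ g → K g → ¬ (∀ x → T (inc H g x) → T (T' x))

independent⇒independentOn : ∀ {H K T'} → Independent H T' → IndependentOn H K T'
independent⇒independentOn independent g _ inside = independent (g , inside)

module UnionIndependence (C₁ C₂ : Config) (v₁ : V (G C₁)) (v₂ : V (G C₂)) {K : E (H C₁) ⊎ E (H C₂) → Set} where

  independentOn-union⁺ : ∀ {T'} → IndependentOn (H C₁) (K ∘ inj₁) (T' ∘ inj₁) →
                         IndependentOn (H C₂) (K ∘ inj₂) (T' ∘ inj₂) →
                         IndependentOn (unionH C₁ C₂ v₁ v₂) K T'
  independentOn-union⁺ ind₁ _ (inj₁ g) k inside = ind₁ g k (inside ∘ inj₁)
  independentOn-union⁺ _ ind₂ (inj₂ g) k inside = ind₂ g k (inside ∘ inj₂)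

  independentOn-union⁻₁ : ∀ {T'} → IndependentOn (unionH C₁ C₂ v₁ v₂) K T' →
                          IndependentOn (H C₁) (K ∘ inj₁) (T' ∘ inj₁)
  independentOn-union⁻₁ independent g k inside =
    independent (inj₁ g) k λ { (inj₁ x) x∈ → inside x x∈ ; (inj₂ _) () }

  independentOn-union⁻₂ : ∀ {T'} → IndependentOn (unionH C₁ C₂ v₁ v₂) K T' →
                          IndependentOn (H C₂) (K ∘ inj₂) (T' ∘ inj₂)
  independentOn-union⁻₂ independent g k inside =
    independent (inj₂ g) k λ { (inj₁ _) () ; (inj₂ y) y∈ → inside y y∈ }

-- C can be coloured when only the edges g of H with K g are kept.
record ColourableOn (C : Config) (K : E (H C) → Set) : Set where
  constructor colouring
  field
    colour        : V (H C) → Bool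
    independentOn : IndependentOn (H C) K colour
    isTransversal : Transversal (X C) Everywhere colour

ColourableOn-mono : ∀ {C K K'} → (∀ g → K' g → K g) → ColourableOn C K → ColourableOn C K'
ColourableOn-mono K'⊆K (colouring T' independent tr) = colouring T' (λ g → independent g ∘ K'⊆K g) tr

MinimalUncolourableOn : Config → Set
MinimalUncolourableOn C = ¬ ColourableOn C Everywhere × (∀ f → ColourableOn C (_≢ f))

minimalUncolourable⇔ : ∀ C → MinimalUncolorable C ⇔ MinimalUncolourableOn C
minimalUncolourable⇔ C = mk⇔
  (λ (uncolourable , critical) → uncolourable ∘ toColorable , fromDeleted ∘ critical)
  (λ (uncolourable , critical) → uncolourable ∘ fromColorable , toDeleted ∘ critical)
  where
  fromColorable : Colorable C → ColourableOn C Everywhere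
  fromColorable (T' , independent , one) =
    colouring T' (independent⇒independentOn independent) (fullTransversal one)
  toColorable : ColourableOn C Everywhere → Colorable C
  toColorable (colouring T' independent tr) =
    T' , (λ (g , inside) → independent g tt inside) , λ w → Transversal.exactlyOne tr w tt
  fromDeleted : ∀ {f} → Colorable' (G C) (deleteEdge (H C) f) (X C) → ColourableOn C (_≢ f)
  fromDeleted (T' , independent , one) =
    colouring T' (λ g g≢f inside → independent ((g , g≢f) , inside)) (fullTransversal one)
  toDeleted : ∀ {f} → ColourableOn C (_≢ f) → Colorable' (G C) (deleteEdge (H C) f) (X C)
  toDeleted (colouring T' independent tr) =
    T' , (λ ((g , g≢f) , inside) → independent g g≢f inside) , λ w → Transversal.exactlyOne tr w tt

recompute≢ : {A : Set} {a b : A} → .(a ≢ b) → a ≢ b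
recompute≢ a≢b a≡b = ⊥-elim-irr (a≢b a≡b)

-- Transversals of the merged classes: X_{v*} = X¹_{v¹} ∪ X²_{v²}, so a
-- transversal of the merge is a transversal of one side glued to a
-- transversal of the other side that avoids the merged vertex.
module MergedTransversals (C₁ C₂ : Config) (v₁ : V (G C₁)) (v₂ : V (G C₂)) where
  private
    X* : MergedV C₁ C₂ v₁ v₂ → V (H C₁) ⊎ V (H C₂) → Bool
    X* = mergedX C₁ C₂ v₁ v₂

  glue₁ : ∀ {T₁ T₂} → Transversal (X C₁) Everywhere T₁ → Transversal (X C₂) (_≢ v₂) T₂ →
          Transversal X* Everywhere [ T₁ , T₂ ]
  glue₁ {T₁} {T₂} (transversal one₁ _) (transversal one₂ avoids₂) =
    fullTransversal one
    where
    one : ∀ w → ExactlyOne (λ x → T ([ T₁ , T₂ ] x) × T (X* w x))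
    one star        = ExactlyOne-inj₁⁺ (λ y (t , yv) → avoids₂ v₂ (λ v₂≢v₂ → v₂≢v₂ refl) y t yv) (one₁ v₁ tt)
    one (left w _)  = ExactlyOne-inj₁⁺ (λ _ ()) (one₁ w tt)
    one (right w p) = ExactlyOne-inj₂⁺ (λ _ ()) (one₂ w (recompute≢ p))

  glue₂ : ∀ {T₁ T₂} → Transversal (X C₁) (_≢ v₁) T₁ → Transversal (X C₂) Everywhere T₂ →
          Transversal X* Everywhere [ T₁ , T₂ ]
  glue₂ {T₁} {T₂} (transversal one₁ avoids₁) (transversal one₂ _) =
    fullTransversal one
    where
    one : ∀ w → ExactlyOne (λ x → T ([ T₁ , T₂ ] x) × T (X* w x))
    one star        = ExactlyOne-inj₂⁺ (λ y (t , yv) → avoids₁ v₁ (λ v₁≢v₁ → v₁≢v₁ refl) y t yv) (one₂ v₂ tt)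
    one (left w p)  = ExactlyOne-inj₁⁺ (λ _ ()) (one₁ w (recompute≢ p))
    one (right w _) = ExactlyOne-inj₂⁺ (λ _ ()) (one₂ w tt)

  -- the side containing the chosen vertex of X_{v*} is fully transversed
  restrict : DecidableEquality (V (G C₁)) → DecidableEquality (V (G C₂)) →
             ∀ {T'} → Transversal X* Everywhere T' →
             Transversal (X C₁) Everywhere (T' ∘ inj₁) ⊎ Transversal (X C₂) Everywhere (T' ∘ inj₂)
  restrict _≟₁_ _≟₂_ {T'} (transversal one _) with one star tt
  ... | inj₁ x , chosen , unique = inj₁ (fullTransversal one₁)
    where
    one₁ : ∀ w → ExactlyOne (λ y → T (T' (inj₁ y)) × T (X C₁ w y))
    one₁ w with w ≟₁ v₁
    ... | yes refl = ExactlyOne-inj₁ chosen unique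
    ... | no w≢v₁  = ExactlyOne-inj₁⁻ (λ _ ()) (one (left w w≢v₁) tt)
  ... | inj₂ x , chosen , unique = inj₂ (fullTransversal one₂)
    where
    one₂ : ∀ w → ExactlyOne (λ y → T (T' (inj₂ y)) × T (X C₂ w y))
    one₂ w with w ≟₂ v₂
    ... | yes refl = ExactlyOne-inj₂ chosen unique
    ... | no w≢v₂  = ExactlyOne-inj₂⁻ (λ _ ()) (one (right w w≢v₂) tt)

-- Colourings of the merge, given colourings of both sides avoiding the
-- merged vertices: the merge is colourable (on the kept edges K) iff one
-- of the sides is.
module MergedColourings (C₁ C₂ : Config) (v₁ : V (G C₁)) (v₂ : V (G C₂))
         (_≟₁_ : DecidableEquality (V (G C₁))) (_≟₂_ : DecidableEquality (V (G C₂)))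
         (avoiding₁ : Σ (V (H C₁) → Bool) (PartialColoring C₁ (_≢ v₁)))
         (avoiding₂ : Σ (V (H C₂) → Bool) (PartialColoring C₂ (_≢ v₂))) where
  open MergedTransversals C₁ C₂ v₁ v₂
  open UnionIndependence C₁ C₂ v₁ v₂

  C* : Config
  C* = merge C₁ C₂ v₁ v₂

  extend₁ : ∀ K → ColourableOn C₁ (K ∘ inj₁) → ColourableOn C* K
  extend₁ _ (colouring T₁ independent₁ tr₁) =
    let T₂ , partialColoring independent₂ tr₂ = avoiding₂ in
    colouring [ T₁ , T₂ ]
      (independentOn-union⁺ independent₁ (independent⇒independentOn independent₂))
      (glue₁ tr₁ tr₂)

  extend₂ : ∀ K → ColourableOn C₂ (K ∘ inj₂) → ColourableOn C* K
  extend₂ _ (colouring T₂ independent₂ tr₂) =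
    let T₁ , partialColoring independent₁ tr₁ = avoiding₁ in
    colouring [ T₁ , T₂ ]
      (independentOn-union⁺ (independent⇒independentOn independent₁) independent₂)
      (glue₂ tr₁ tr₂)

  restrictColouring : ∀ K → ColourableOn C* K → ColourableOn C₁ (K ∘ inj₁) ⊎ ColourableOn C₂ (K ∘ inj₂)
  restrictColouring _ (colouring T' independent tr) with restrict _≟₁_ _≟₂_ tr
  ... | inj₁ tr₁ = inj₁ (colouring (T' ∘ inj₁) (independentOn-union⁻₁ independent) tr₁)
  ... | inj₂ tr₂ = inj₂ (colouring (T' ∘ inj₂) (independentOn-union⁻₂ independent) tr₂)

  bothMinimal⇒merged : MinimalUncolourableOn C₁ → MinimalUncolourableOn C₂ → MinimalUncolourableOn C*
  bothMinimal⇒merged (uncolourable₁ , critical₁) (uncolourable₂ , critical₂) =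
    [ uncolourable₁ , uncolourable₂ ] ∘ restrictColouring Everywhere , critical
    where
    critical : ∀ f → ColourableOn C* (_≢ f)
    critical (inj₁ f) = extend₁ (_≢ inj₁ f) (ColourableOn-mono (λ g ne → ne ∘ cong inj₁) (critical₁ f))
    critical (inj₂ f) = extend₂ (_≢ inj₂ f) (ColourableOn-mono (λ g ne → ne ∘ cong inj₂) (critical₂ f))

  merged⇒bothMinimal : MinimalUncolourableOn C* → MinimalUncolourableOn C₁ × MinimalUncolourableOn C₂
  merged⇒bothMinimal (uncolourable , critical) =
    (uncolourable ∘ extend₁ Everywhere , critical₁) , (uncolourable ∘ extend₂ Everywhere , critical₂)
    where
    critical₁ : ∀ f → ColourableOn C₁ (_≢ f)
    critical₁ f with restrictColouring (_≢ inj₁ f) (critical (inj₁ f))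
    ... | inj₁ colourable₁ = ColourableOn-mono (λ g ne → ne ∘ inj₁-injective) colourable₁
    ... | inj₂ colourable₂ = ⊥-elim (uncolourable (extend₂ Everywhere (ColourableOn-mono (λ _ _ ()) colourable₂)))
    critical₂ : ∀ f → ColourableOn C₂ (_≢ f)
    critical₂ f with restrictColouring (_≢ inj₂ f) (critical (inj₂ f))
    ... | inj₁ colourable₁ = ⊥-elim (uncolourable (extend₁ Everywhere (ColourableOn-mono (λ _ _ ()) colourable₁)))
    ... | inj₂ colourable₂ = ColourableOn-mono (λ g ne → ne ∘ inj₂-injective) colourable₂

module MergedConfiguration (C₁ C₂ : Config) (v₁ : V (G C₁)) (v₂ : V (G C₂))
                           (df₁ : DegreeFeasible C₁) (df₂ : DegreeFeasible C₂) where
  private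
    module P₁ = DegreeFeasibleParts df₁
    module P₂ = DegreeFeasibleParts df₂

  V* : Set
  V* = MergedV C₁ C₂ v₁ v₂

  G* : Hypergraph
  G* = mergedG C₁ C₂ v₁ v₂

  H* : Hypergraph
  H* = unionH C₁ C₂ v₁ v₂

  X* : V* → V (H C₁) ⊎ V (H C₂) → Bool
  X* = mergedX C₁ C₂ v₁ v₂

  _∈*_ : V* → E G* → Set
  u ∈* e = T (inc G* e u)

  ι₁ : V (G C₁) → V*
  ι₁ v with v P₁.≟ᴳ v₁
  ... | yes _   = star
  ... | no v≢v₁ = left v v≢v₁

  ι₂ : V (G C₂) → V*
  ι₂ w with w P₂.≟ᴳ v₂
  ... | yes _   = star
  ... | no w≢v₂ = right w w≢v₂

  ι₁-v₁ : ι₁ v₁ ≡ star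
  ι₁-v₁ with v₁ P₁.≟ᴳ v₁
  ... | yes _    = refl
  ... | no v₁≢v₁ = ⊥-elim (v₁≢v₁ refl)

  ι₂-v₂ : ι₂ v₂ ≡ star
  ι₂-v₂ with v₂ P₂.≟ᴳ v₂
  ... | yes _    = refl
  ... | no v₂≢v₂ = ⊥-elim (v₂≢v₂ refl)

  ι₁-left : ∀ v .(v≢v₁ : v ≢ v₁) → ι₁ v ≡ left v v≢v₁
  ι₁-left v v≢v₁ with v P₁.≟ᴳ v₁
  ... | yes v≡v₁ = ⊥-elim (recompute≢ v≢v₁ v≡v₁)
  ... | no _     = refl

  ι₂-right : ∀ w .(w≢v₂ : w ≢ v₂) → ι₂ w ≡ right w w≢v₂
  ι₂-right w w≢v₂ with w P₂.≟ᴳ v₂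
  ... | yes w≡v₂ = ⊥-elim (recompute≢ w≢v₂ w≡v₂)
  ... | no _     = refl

  ι₁-injective : ∀ {a b} → ι₁ a ≡ ι₁ b → a ≡ b
  ι₁-injective {a} {b} eq with a P₁.≟ᴳ v₁ | b P₁.≟ᴳ v₁ | eq
  ... | yes refl | yes refl | _    = refl
  ... | no _     | no _     | refl = refl

  ι₂-injective : ∀ {a b} → ι₂ a ≡ ι₂ b → a ≡ b
  ι₂-injective {a} {b} eq with a P₂.≟ᴳ v₂ | b P₂.≟ᴳ v₂ | eq
  ... | yes refl | yes refl | _    = refl
  ... | no _     | no _     | refl = refl

  ι₁-inc : ∀ e v → inc G* (inj₁ e) (ι₁ v) ≡ inc (G C₁) e v
  ι₁-inc e v with v P₁.≟ᴳ v₁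
  ... | yes refl = refl
  ... | no _     = refl

  ι₂-inc : ∀ e w → inc G* (inj₂ e) (ι₂ w) ≡ inc (G C₂) e w
  ι₂-inc e w with w P₂.≟ᴳ v₂
  ... | yes refl = refl
  ... | no _     = refl

  ι₁-X : ∀ v x → X* (ι₁ v) (inj₁ x) ≡ X C₁ v x
  ι₁-X v x with v P₁.≟ᴳ v₁
  ... | yes refl = refl
  ... | no _     = refl

  ι₂-X : ∀ w y → X* (ι₂ w) (inj₂ y) ≡ X C₂ w y
  ι₂-X w y with w P₂.≟ᴳ v₂
  ... | yes refl = refl
  ... | no _     = refl

  fromSide : ∀ u → (∃ λ a → ι₁ a ≡ u) ⊎ (∃ λ b → ι₂ b ≡ u)
  fromSide star          = inj₁ (v₁ , ι₁-v₁)
  fromSide (left v p)    = inj₁ (v , ι₁-left v p)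
  fromSide (right w p)   = inj₂ (w , ι₂-right w p)

  X*-inj₁ : ∀ u x → T (X* u (inj₁ x)) → ∃ λ a → ι₁ a ≡ u × T (X C₁ a x)
  X*-inj₁ star        x xu = v₁ , ι₁-v₁ , xu
  X*-inj₁ (left v p)  x xu = v , ι₁-left v p , xu

  X*-inj₂ : ∀ u y → T (X* u (inj₂ y)) → ∃ λ b → ι₂ b ≡ u × T (X C₂ b y)
  X*-inj₂ star        y yu = v₂ , ι₂-v₂ , yu
  X*-inj₂ (right w p) y yu = w , ι₂-right w p , yu

  inc*-inj₁ : ∀ e u → u ∈* inj₁ e → ∃ λ a → ι₁ a ≡ u × a P₁.∈ᴳ e
  inc*-inj₁ e star       u∈ = v₁ , ι₁-v₁ , u∈
  inc*-inj₁ e (left v p) u∈ = v , ι₁-left v p , u∈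

  inc*-inj₂ : ∀ e u → u ∈* inj₂ e → ∃ λ b → ι₂ b ≡ u × b P₂.∈ᴳ e
  inc*-inj₂ e star        u∈ = v₂ , ι₂-v₂ , u∈
  inc*-inj₂ e (right w p) u∈ = w , ι₂-right w p , u∈

  finite-V* : IsFinite V*
  finite-V* with k , ⊤⊎rest↔k ← finite-⊎ finite-⊤ (finite-⊎ (finite-without P₁.finiteVᴳ v₁)
                                                            (finite-without P₂.finiteVᴳ v₂))
    = k , ⊤⊎rest↔k ↔-∘ mk↔ₛ′ to from (λ { (inj₁ tt) → refl ; (inj₂ (inj₁ _)) → refl ; (inj₂ (inj₂ _)) → refl })
                                       (λ { star → refl ; (left _ _) → refl ; (right _ _) → refl })
    where
    to : V* → ⊤ ⊎ (Refinement (V (G C₁)) (_≢ v₁) ⊎ Refinement (V (G C₂)) (_≢ v₂))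
    to star        = inj₁ tt
    to (left v p)  = inj₂ (inj₁ (v , Irrelevant.[ p ]))
    to (right w p) = inj₂ (inj₂ (w , Irrelevant.[ p ]))
    from : ⊤ ⊎ (Refinement (V (G C₁)) (_≢ v₁) ⊎ Refinement (V (G C₂)) (_≢ v₂)) → V*
    from (inj₁ tt)               = star
    from (inj₂ (inj₁ (v , Irrelevant.[ p ]))) = left v p
    from (inj₂ (inj₂ (w , Irrelevant.[ p ]))) = right w p

  twoEnds* : ∀ e → ∃[ u ] ∃[ w ] (u ≢ w × u ∈* e × w ∈* e)
  twoEnds* (inj₁ e) with a , b , a≢b , a∈ , b∈ ← P₁.twoEndsᴳ e =
    ι₁ a , ι₁ b , a≢b ∘ ι₁-injective , subst T (sym (ι₁-inc e a)) a∈ , subst T (sym (ι₁-inc e b)) b∈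
  twoEnds* (inj₂ e) with a , b , a≢b , a∈ , b∈ ← P₂.twoEndsᴳ e =
    ι₂ a , ι₂ b , a≢b ∘ ι₂-injective , subst T (sym (ι₂-inc e a)) a∈ , subst T (sym (ι₂-inc e b)) b∈

  twoEndsᴴ* : ∀ f → ∃[ x ] ∃[ y ] (x ≢ y × T (inc H* f x) × T (inc H* f y))
  twoEndsᴴ* (inj₁ f) with x , y , x≢y , x∈ , y∈ ← P₁.twoEndsᴴ f = inj₁ x , inj₁ y , x≢y ∘ inj₁-injective , x∈ , y∈
  twoEndsᴴ* (inj₂ f) with x , y , x≢y , x∈ , y∈ ← P₂.twoEndsᴴ f = inj₂ x , inj₂ y , x≢y ∘ inj₂-injective , x∈ , y∈

  -- hyperpaths of each side survive in the merge, and the sides meet at v*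
  path₁ : ∀ a b → Star (Adjacent G*) (ι₁ a) (ι₁ b)
  path₁ a b = gmap ι₁ (λ { {c} {d} (e , c∈ , d∈) → inj₁ e , subst T (sym (ι₁-inc e c)) c∈ , subst T (sym (ι₁-inc e d)) d∈ })
                (P₁.connected a b)

  path₂ : ∀ a b → Star (Adjacent G*) (ι₂ a) (ι₂ b)
  path₂ a b = gmap ι₂ (λ { {c} {d} (e , c∈ , d∈) → inj₂ e , subst T (sym (ι₂-inc e c)) c∈ , subst T (sym (ι₂-inc e d)) d∈ })
                (P₂.connected a b)

  ι₁v₁≡ι₂v₂ : ι₁ v₁ ≡ ι₂ v₂
  ι₁v₁≡ι₂v₂ = trans ι₁-v₁ (sym ι₂-v₂)

  connected* : Connected G*
  connected* u w with fromSide u | fromSide w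
  ... | inj₁ (a , refl) | inj₁ (b , refl) = path₁ a b
  ... | inj₂ (a , refl) | inj₂ (b , refl) = path₂ a b
  ... | inj₁ (a , refl) | inj₂ (b , refl) =
    path₁ a v₁ ◅◅ subst (λ z → Star (Adjacent G*) z (ι₂ b)) (sym ι₁v₁≡ι₂v₂) (path₂ v₂ b)
  ... | inj₂ (a , refl) | inj₁ (b , refl) =
    path₂ a v₂ ◅◅ subst (λ z → Star (Adjacent G*) z (ι₁ b)) ι₁v₁≡ι₂v₂ (path₁ v₁ b)

  disjoint* : ∀ u w → u ≢ w → ∀ x → T (X* u x) → T (X* w x) → ⊥
  disjoint* u w u≢w (inj₁ x) xu xw with X*-inj₁ u x xu | X*-inj₁ w x xw
  ... | a , refl , xa | b , refl , xb = P₁.disjoint a b (λ { refl → u≢w refl }) x xa xb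
  disjoint* u w u≢w (inj₂ y) yu yw with X*-inj₂ u y yu | X*-inj₂ w y yw
  ... | a , refl , ya | b , refl , yb = P₂.disjoint a b (λ { refl → u≢w refl }) y ya yb

  covered* : ∀ x → ∃[ u ] T (X* u x)
  covered* (inj₁ x) with a , xa ← P₁.covered x = ι₁ a , subst T (sym (ι₁-X a x)) xa
  covered* (inj₂ y) with b , yb ← P₂.covered y = ι₂ b , subst T (sym (ι₂-X b y)) yb

  -- an edge inside a merged class lies inside a class of its side
  classIndependent* : ∀ u → Independent H* (X* u)
  classIndependent* u (inj₁ g , inside) with x , _ , _ , x∈ , _ ← P₁.twoEndsᴴ g
                                         with a , refl , _ ← X*-inj₁ u x (inside (inj₁ x) x∈)
    = P₁.classIndependent a (g , λ y y∈ → subst T (ι₁-X a y) (inside (inj₁ y) y∈))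
  classIndependent* u (inj₂ g , inside) with x , _ , _ , x∈ , _ ← P₂.twoEndsᴴ g
                                         with b , refl , _ ← X*-inj₂ u x (inside (inj₂ x) x∈)
    = P₂.classIndependent b (g , λ y y∈ → subst T (ι₂-X b y) (inside (inj₂ y) y∈))

  M* : E G* → E H* → Bool
  M* (inj₁ e) (inj₁ f) = P₁.M e f
  M* (inj₂ e) (inj₂ f) = P₂.M e f
  M* (inj₁ _) (inj₂ _) = false
  M* (inj₂ _) (inj₁ _) = false

  M*-inside : ∀ e f → T (M* e f) → ∀ x → T (inc H* f x) → ∃[ u ] (u ∈* e × T (X* u x))
  M*-inside (inj₁ e) (inj₁ f) m (inj₁ x) x∈ with a , a∈ , xa ← P₁.M-inside e f m x x∈ =
    ι₁ a , subst T (sym (ι₁-inc e a)) a∈ , subst T (sym (ι₁-X a x)) xa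
  M*-inside (inj₂ e) (inj₂ f) m (inj₂ y) y∈ with b , b∈ , yb ← P₂.M-inside e f m y y∈ =
    ι₂ b , subst T (sym (ι₂-inc e b)) b∈ , subst T (sym (ι₂-X b y)) yb

  M*-matching : ∀ e f f' → T (M* e f) → T (M* e f') → f ≢ f' →
                ∀ x → T (inc H* f x) → T (inc H* f' x) → ⊥
  M*-matching (inj₁ e) (inj₁ f) (inj₁ f') m m' f≢f' (inj₁ x) = P₁.M-matching e f f' m m' (f≢f' ∘ cong inj₁) x
  M*-matching (inj₂ e) (inj₂ f) (inj₂ f') m m' f≢f' (inj₂ y) = P₂.M-matching e f f' m m' (f≢f' ∘ cong inj₂) y

  M*-meets : ∀ e f → T (M* e f) → ∀ u → u ∈* e → ExactlyOne (λ x → T (inc H* f x) × T (X* u x))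
  M*-meets (inj₁ e) (inj₁ f) m u u∈ with a , refl , a∈ ← inc*-inj₁ e u u∈ =
    ExactlyOne-inj₁⁺ (λ { _ (() , _) })
      (ExactlyOne-resp (λ x (x∈ , xa) → x∈ , subst T (sym (ι₁-X a x)) xa)
                       (λ x (x∈ , xa) → x∈ , subst T (ι₁-X a x) xa) (P₁.M-meets e f m a a∈))
  M*-meets (inj₂ e) (inj₂ f) m u u∈ with b , refl , b∈ ← inc*-inj₂ e u u∈ =
    ExactlyOne-inj₂⁺ (λ { _ (() , _) })
      (ExactlyOne-resp (λ y (y∈ , yb) → y∈ , subst T (sym (ι₂-X b y)) yb)
                       (λ y (y∈ , yb) → y∈ , subst T (ι₂-X b y) yb) (P₂.M-meets e f m b b∈))

  M*-covers : ∀ f → ∃[ e ] T (M* e f)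
  M*-covers (inj₁ f) with e , m ← P₁.M-covers f = inj₁ e , m
  M*-covers (inj₂ f) with e , m ← P₂.M-covers f = inj₂ e , m

  cover* : IsCover G* H* X*
  cover* = disjoint* , covered* , classIndependent* , M* , M*-inside , M*-matching , M*-meets , M*-covers

  degree* : ∀ u → Σ (E G*) (u ∈*_) ↣ Σ (V H*) (T ∘ X* u)
  degree* star        = injection-Σ⊎ _ _ (P₁.degree v₁) (P₂.degree v₂)
  degree* (left v _)  = injection-Σ⊎ _ _ (P₁.degree v) injection-∅
  degree* (right w _) = injection-Σ⊎ _ _ injection-∅ (P₂.degree w)

  degreeFeasible* : DegreeFeasible (merge C₁ C₂ v₁ v₂)
  degreeFeasible* =
    ((finite-V* , finite-⊎ P₁.finiteEᴳ P₂.finiteEᴳ , twoEnds*) ,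
     (finite-⊎ P₁.finiteVᴴ P₂.finiteVᴴ , finite-⊎ P₁.finiteEᴴ P₂.finiteEᴴ , twoEndsᴴ*) ,
     connected* , cover*) ,
    degree*

proposition6 : (C₁ C₂ : Config) (v₁ : V (G C₁)) (v₂ : V (G C₂)) →
    DegreeFeasible C₁ → DegreeFeasible C₂ →
    DegreeFeasible (merge C₁ C₂ v₁ v₂) ×
    ((MinimalUncolorable C₁ × MinimalUncolorable C₂) ⇔
      MinimalUncolorable (merge C₁ C₂ v₁ v₂))
proposition6 C₁ C₂ v₁ v₂ df₁ df₂ =
  MergedConfiguration.degreeFeasible* C₁ C₂ v₁ v₂ df₁ df₂ ,
  mk⇔ (λ (minimal₁ , minimal₂) → from* (bothMinimal⇒merged (to₁ minimal₁) (to₂ minimal₂)))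
      (λ minimal* → let minimal₁ , minimal₂ = merged⇒bothMinimal (to* minimal*)
                    in from₁ minimal₁ , from₂ minimal₂)
  where
  open MergedColourings C₁ C₂ v₁ v₂
         (DegreeFeasibleParts._≟ᴳ_ df₁) (DegreeFeasibleParts._≟ᴳ_ df₂)
         (AvoidVertex.colouring df₁ v₁) (AvoidVertex.colouring df₂ v₂)
  open Equivalence (minimalUncolourable⇔ C₁) renaming (to to to₁; from to from₁)
  open Equivalence (minimalUncolourable⇔ C₂) renaming (to to to₂; from to from₂)
  open Equivalence (minimalUncolourable⇔ C*) renaming (to to to*; from to from*)
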